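{- Let $n\ge1$ be an odd integer, $n_1=(n+1)/2$, $n_0=(n-1)/2$, and let $k\in K=\mathrm{GL}_2(\mathfrak{o})$. Then: (1) $l(ka(\varpi^{n_1}))\ge n_1$ if and only if $k\in N(\mathfrak{o})K^0(\mathfrak{p})$; (2) $l(ka(\varpi^{n_1}))\le n_0$ if and only if $k\in wK^0(\mathfrak{p})$.
   Context: $F$ is a non-archimedean local field of characteristic zero, $\mathfrak{o}$ its ring of integers, $\mathfrak{p}$ the maximal ideal, $\varpi$ a uniformizer. $G=\mathrm{GL}_2(F)$, $K_1(\mathfrak{p}^k)=\{\begin{smallmatrix} a&b\\c&d\end{smallmatrix}\in K: c\in\mathfrak{p}^k,\ a\in1+\mathfrak{p}^k\}$, $K^0(\mathfrak{p})=\{\begin{smallmatrix} a&b\\c&d\end{smallmatrix}\in K: b\in\mathfrak{p}\}$, $w=\begin{smallmatrix}0&1\\-1&0\end{smallmatrix}$, $a(y)=\mathrm{diag}(y,1)$, $n(x)=\begin{smallmatrix}1&x\\0&1\end{smallmatrix}$, $N=\{n(x):x\in F\}$, $N(\mathfrak{o})=\{n(x):x\in\mathfrak{o}\}$, $Z$ the center. Every $g\in G$ lies in $ZNa(\varpi^t)wn(\varpi^{ -l}v)K_1(\mathfrak{p}^n)$ for a unique pair of integers $(t,l)$ with $0\le l\le n$ and some $v\in\mathfrak{o}^\times$; $l(g)$ denotes this $l$ (and $t(g)$ this $t$). -}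

module Defs where

open import Level using (Level; _⊔_; suc)
open import Algebra.Bundles using (CommutativeRing)
open import Data.Nat as ℕ using (ℕ; zero)
open import Data.Integer as ℤ using (ℤ; +_; -[1+_])
open import Data.List using (List)
open import Data.List.Membership.Propositional using (_∈_)
open import Data.Product using (Σ; ∃; _×_; _,_; ∃-syntax)
open import Relation.Nullary using (¬_)

-- A non-archimedean local field of characteristic zero, presented by its
-- field structure (a commutative ring in which every nonzero element is
-- invertible), its ring of integers 𝔬 (a predicate on F) and a
-- uniformizer ϖ, such that:
--   * 𝔬 is a subring, ϖ ∈ 𝔬 is not a unit of 𝔬, and every nonzero
--     x ∈ F is ϖ^m · u with m ∈ ℤ and u ∈ 𝔬ˣ (so 𝔬 is the valuation ring
--     of a discrete valuation with uniformizer ϖ, and 𝔭 = ϖ𝔬);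
--   * F is complete for the 𝔭-adic topology;
--   * the residue field 𝔬/𝔭 is finite;
--   * F has characteristic zero.

module Notation {c ℓ : Level} (R : CommutativeRing c ℓ)
  (𝔬 : CommutativeRing.Carrier R → Set ℓ) (ϖ ϖ⁻¹ : CommutativeRing.Carrier R) where
  open CommutativeRing R

  natCast : ℕ → Carrier
  natCast zero      = 0#
  natCast (ℕ.suc m) = 1# + natCast m

  ϖ^ℕ : ℕ → Carrier
  ϖ^ℕ zero       = 1#
  ϖ^ℕ (ℕ.suc k)  = ϖ * ϖ^ℕ k

  ϖ⁻^ℕ : ℕ → Carrier
  ϖ⁻^ℕ zero      = 1#
  ϖ⁻^ℕ (ℕ.suc k) = ϖ⁻¹ * ϖ⁻^ℕ k

  ϖ^ : ℤ → Carrier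
  ϖ^ (+ k)      = ϖ^ℕ k
  ϖ^ -[1+ k ]   = ϖ⁻^ℕ (ℕ.suc k)

  𝔬ˣ : Carrier → Set (c ⊔ ℓ)
  𝔬ˣ x = 𝔬 x × ∃[ y ] (𝔬 y × x * y ≈ 1#)

  𝔭^ : ℕ → Carrier → Set (c ⊔ ℓ)
  𝔭^ k x = ∃[ y ] (𝔬 y × x ≈ ϖ^ℕ k * y)


record LocalField (c ℓ : Level) : Set (suc (c ⊔ ℓ)) where
  field
    cring : CommutativeRing c ℓ
  open CommutativeRing cring public

  field
    inv      : ∀ x → ¬ (x ≈ 0#) → ∃[ y ] (x * y ≈ 1#)
    nontriv  : ¬ (1# ≈ 0#)
    𝔬        : Carrier → Set ℓ
    𝔬-resp   : ∀ {x y} → x ≈ y → 𝔬 x → 𝔬 y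
    𝔬-0      : 𝔬 0#
    𝔬-1      : 𝔬 1#
    𝔬-+      : ∀ {x y} → 𝔬 x → 𝔬 y → 𝔬 (x + y)
    𝔬-neg    : ∀ {x} → 𝔬 x → 𝔬 (- x)
    𝔬-*      : ∀ {x y} → 𝔬 x → 𝔬 y → 𝔬 (x * y)
    ϖ        : Carrier
    ϖ⁻¹      : Carrier
    ϖϖ⁻¹     : ϖ * ϖ⁻¹ ≈ 1#
    𝔬-ϖ      : 𝔬 ϖ
    ϖ-nonunit : ¬ 𝔬 ϖ⁻¹

  open Notation cring 𝔬 ϖ ϖ⁻¹ public

  field
    dvr      : ∀ x → ¬ (x ≈ 0#) → ∃[ m ] ∃[ u ] (𝔬ˣ u × x ≈ ϖ^ m * u)
    complete : (s : ℕ → Carrier) →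
               (∀ k → ∃[ N ] (∀ i j → N ℕ.≤ i → N ℕ.≤ j → 𝔭^ k (s i - s j))) →
               ∃[ x ] (∀ k → ∃[ N ] (∀ i → N ℕ.≤ i → 𝔭^ k (s i - x)))
    residue-finite : ∃[ reps ] (∀ x → 𝔬 x → ∃[ r ] (r ∈ reps × 𝔬 r × 𝔭^ 1 (x - r)))
    char0    : ∀ (m : ℕ) → ¬ (natCast (ℕ.suc m) ≈ 0#)

module GL2 {c ℓ : Level} (L : LocalField c ℓ) where
  open LocalField L

  record M2 : Set c where
    constructor mat
    field
      a b c' d : Carrier
  open M2 public

  infixl 7 _·_
  _·_ : M2 → M2 → M2
  mat a₁ b₁ c₁ d₁ · mat a₂ b₂ c₂ d₂ =
    mat (a₁ * a₂ + b₁ * c₂) (a₁ * b₂ + b₁ * d₂)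
        (c₁ * a₂ + d₁ * c₂) (c₁ * b₂ + d₁ * d₂)

  infix 4 _≈M_
  _≈M_ : M2 → M2 → Set ℓ
  g ≈M h = (a g ≈ a h) × (b g ≈ b h) × (c' g ≈ c' h) × (d g ≈ d h)

  det : M2 → Carrier
  det g = a g * d g - b g * c' g

  InG : M2 → Set ℓ
  InG g = ¬ (det g ≈ 0#)

  w : M2
  w = mat 0# 1# (- 1#) 0#

  a[_] : Carrier → M2
  a[ y ] = mat y 0# 0# 1#

  n[_] : Carrier → M2
  n[ x ] = mat 1# x 0# 1#

  scalar : Carrier → M2
  scalar z = mat z 0# 0# z

  InK : M2 → Set (c ⊔ ℓ)
  InK g = 𝔬 (a g) × 𝔬 (b g) × 𝔬 (c' g) × 𝔬 (d g) × 𝔬ˣ (det g)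

  InK1 : ℕ → M2 → Set (c ⊔ ℓ)
  InK1 k g = InK g × 𝔭^ k (c' g) × 𝔭^ k (a g - 1#)

  InK⁰ : M2 → Set (c ⊔ ℓ)
  InK⁰ g = InK g × 𝔭^ 1 (b g)

  -- g ∈ Z N a(ϖ^t) w n(ϖ^{-l} v) K₁(𝔭^n) with 0 ≤ l ≤ n, v ∈ 𝔬ˣ.
  -- (By the standing fact of the paper, for g ∈ G such (t,l) exists and is
  -- unique; l(g) is that l.)
  HasTL : (n : ℕ) → M2 → ℤ → ℕ → Set (c ⊔ ℓ)
  HasTL n g t l =
    l ℕ.≤ n ×
    ∃[ z ] ∃[ x ] ∃[ v ] ∃[ κ ]
      ( ¬ (z ≈ 0#) × 𝔬ˣ v × InK1 n κ ×
        g ≈M scalar z · n[ x ] · a[ ϖ^ t ] · w · n[ ϖ^ (ℤ.- (+ l)) * v ] · κ )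

  Lval : (n : ℕ) → M2 → ℕ → Set (c ⊔ ℓ)
  Lval n g l = ∃[ t ] HasTL n g t l

  InNoK⁰ : M2 → Set (c ⊔ ℓ)
  InNoK⁰ k = ∃[ x ] ∃[ κ ] (𝔬 x × InK⁰ κ × k ≈M n[ x ] · κ)

  InwK⁰ : M2 → Set (c ⊔ ℓ)
  InwK⁰ k = ∃[ κ ] (InK⁰ κ × k ≈M w · κ)

module Submission where

-- Theorem (odd level n = 2m+1, n₁ = m+1, n₀ = m).  For k ∈ K = GL₂(𝔬) write
-- k·a(ϖ^{m+1}) ∈ Z N a(ϖ^t) w n(ϖ^{-l}v) κ with κ ∈ K₁(𝔭^n).  Comparing bottom
-- rows of both sides and eliminating the central element gives the cell
-- relation
--     d_k · (ϖ^l a_κ + v c_κ) = c_k · ϖ^{m+1} · (ϖ^l b_κ + v d_κ),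
-- in which a_κ, d_κ and v are units and c_κ ∈ 𝔭^{2m+1}.
--   * If l ≥ m+1, the factor ϖ^l b_κ + v d_κ is a unit and ϖ^{m+1} divides
--     ϖ^l a_κ + v c_κ, so (c_k, d_k) satisfies d_k·A = c_k·Y with Y a unit;
--     since det k is a unit this forces d_k ∈ 𝔬ˣ.
--   * If l ≤ m, cancelling ϖ^l leaves d_k·(unit) ∈ ϖ𝔬, so d_k ∈ 𝔭.
-- On the other hand, for k ∈ K one has k ∈ N(𝔬)K⁰(𝔭) iff d_k ∈ 𝔬ˣ, and
-- k ∈ wK⁰(𝔭) iff d_k ∈ 𝔭; these are exclusive, and l ≥ m+1 or l ≤ m always
-- holds, which yields both equivalences.

open import Defs
open import Level using (Level; _⊔_)
open import Algebra.Bundles using (CommutativeRing; RawRing)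
open import Algebra.Solver.Ring.AlmostCommutativeRing
  using (fromCommutativeRing; _-Raw-AlmostCommutative⟶_)
open import Data.Nat as ℕ using (ℕ; zero; suc)
import Data.Nat.Properties as ℕP
open import Data.Nat.DivMod using (m≡m%n+[m/n]*n; m*n/n≡m)
open import Data.Nat.Tactic.RingSolver using (solve-∀)
open import Data.Integer as ℤ using (+_; -[1+_])
open import Data.Maybe using (Maybe; just; nothing)
open import Data.Product using (_×_; _,_; ∃-syntax; proj₁; proj₂)
open import Data.Sum using (_⊎_; inj₁; inj₂)
open import Data.Empty using (⊥; ⊥-elim)
open import Function.Bundles using (_⇔_; mk⇔)
open import Relation.Nullary using (¬_; yes; no)
open import Relation.Binary.PropositionalEquality as P using (_≡_)

exclusive-cases : ∀ {a b x y} {A : Set a} {B : Set b} {X : Set x} {Y : Set y} →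
                  A ⊎ B → (A → X) → (B → Y) → (X → Y → ⊥) → (A ⇔ X) × (B ⇔ Y)
exclusive-cases (inj₁ a) A⇒X B⇒Y excl =
  mk⇔ A⇒X (λ _ → a) , mk⇔ B⇒Y (λ y → ⊥-elim (excl (A⇒X a) y))
exclusive-cases (inj₂ b) A⇒X B⇒Y excl =
  mk⇔ A⇒X (λ x → ⊥-elim (excl x (B⇒Y b))) , mk⇔ B⇒Y (λ _ → b)

-- A ring solver for an arbitrary commutative ring, with integer coefficients
-- represented as pairs (a , b) of naturals standing for a − b.  The
-- standard library only provides natural-number coefficients for general
-- rings, which cannot prove identities involving cancellation of negatives.
module IntegerSolver {c ℓ : Level} (R : CommutativeRing c ℓ) where
  open CommutativeRing R
  open import Algebra.Properties.Semiring.Mult semiring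
    using (×-homo-+; ×1-homo-*) renaming (_×_ to _×ₘ_)
  open import Algebra.Properties.Ring ring using (-‿distribˡ-*; -‿distribʳ-*; -‿involutive)
  open import Algebra.Properties.AbelianGroup +-abelianGroup using (⁻¹-∙-comm)
  import Algebra.Solver.Ring.NaturalCoefficients.Default commutativeSemiring as NS
  open import Relation.Binary.Reasoning.Setoid setoid

  ℤ-as-pairs : RawRing _ _
  ℤ-as-pairs = record
    { Carrier = ℕ × ℕ
    ; _≈_ = _≡_
    ; _+_ = λ { (a , b) (c , d) → (a ℕ.+ c , b ℕ.+ d) }
    ; _*_ = λ { (a , b) (c , d) → (a ℕ.* c ℕ.+ b ℕ.* d , a ℕ.* d ℕ.+ b ℕ.* c) }
    ; -_ = λ { (a , b) → (b , a) }
    ; 0# = (0 , 0)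
    ; 1# = (1 , 0)
    }

  cast : ℕ → Carrier
  cast n = n ×ₘ 1#

  ⟦_⟧ℤ : ℕ × ℕ → Carrier
  ⟦ (a , b) ⟧ℤ = cast a - cast b

  -‿distrib-+ : ∀ x y → - (x + y) ≈ - x + - y
  -‿distrib-+ x y = sym (⁻¹-∙-comm x y)

  +-homo : ∀ p q → ⟦ RawRing._+_ ℤ-as-pairs p q ⟧ℤ ≈ ⟦ p ⟧ℤ + ⟦ q ⟧ℤ
  +-homo (a , b) (c₁ , d) = begin
    cast (a ℕ.+ c₁) - cast (b ℕ.+ d)
      ≈⟨ +-cong (×-homo-+ 1# a c₁) (-‿cong (×-homo-+ 1# b d)) ⟩
    (cast a + cast c₁) + - (cast b + cast d)       ≈⟨ +-congˡ (-‿distrib-+ _ _) ⟩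
    (cast a + cast c₁) + (- cast b + - cast d)
      ≈⟨ NS.solve 4 (λ A C B D → (A :+ C) :+ (B :+ D) := (A :+ B) :+ (C :+ D))
                    refl (cast a) (cast c₁) (- cast b) (- cast d) ⟩
    (cast a - cast b) + (cast c₁ - cast d)         ∎
    where open NS

  *-homo : ∀ p q → ⟦ RawRing._*_ ℤ-as-pairs p q ⟧ℤ ≈ ⟦ p ⟧ℤ * ⟦ q ⟧ℤ
  *-homo (a , b) (c₁ , d) = begin
    cast (a ℕ.* c₁ ℕ.+ b ℕ.* d) - cast (a ℕ.* d ℕ.+ b ℕ.* c₁)
      ≈⟨ +-cong (trans (×-homo-+ 1# (a ℕ.* c₁) (b ℕ.* d)) (+-cong (×1-homo-* a c₁) (×1-homo-* b d)))
                (-‿cong (trans (×-homo-+ 1# (a ℕ.* d) (b ℕ.* c₁)) (+-cong (×1-homo-* a d) (×1-homo-* b c₁)))) ⟩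
    (A * C + B * D) + - (A * D + B * C)
      ≈⟨ +-cong (+-congˡ (sym neg*neg))
                (trans (-‿distrib-+ _ _) (+-cong (-‿distribʳ-* A D) (-‿distribˡ-* B C))) ⟩
    (A * C + - B * - D) + (A * - D + - B * C)
      ≈⟨ NS.solve 4 (λ A C B D → (A :* C :+ B :* D) :+ (A :* D :+ B :* C) := (A :+ B) :* (C :+ D))
                    refl A C (- B) (- D) ⟩
    (A - B) * (C - D)                               ∎
    where
    open NS
    A = cast a
    B = cast b
    C = cast c₁
    D = cast d
    neg*neg : - B * - D ≈ B * D
    neg*neg = trans (sym (-‿distribˡ-* B (- D)))
                    (trans (-‿cong (sym (-‿distribʳ-* B D))) (-‿involutive _))

  -‿homo : ∀ p → ⟦ RawRing.-_ ℤ-as-pairs p ⟧ℤ ≈ - ⟦ p ⟧ℤ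
  -‿homo (a , b) = begin
    cast b - cast a          ≈⟨ +-comm _ _ ⟩
    - cast a + cast b        ≈⟨ +-congˡ (sym (-‿involutive _)) ⟩
    - cast a + - - cast b    ≈⟨ sym (-‿distrib-+ _ _) ⟩
    - (cast a - cast b)      ∎

  -- Equality of coefficients is decided in ℕ: a − b = c − d iff a + d = c + b.
  coefficient-equality : ∀ p q → Maybe (⟦ p ⟧ℤ ≈ ⟦ q ⟧ℤ)
  coefficient-equality (a , b) (c₁ , d) with a ℕ.+ d ℕ.≟ c₁ ℕ.+ b
  ... | no _ = nothing
  ... | yes e = just (begin
    A + - B                   ≈⟨ sym (+-identityʳ _) ⟩
    (A + - B) + 0#            ≈⟨ +-congˡ (sym (-‿inverseʳ D)) ⟩
    (A + - B) + (D + - D)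
      ≈⟨ NS.solve 4 (λ A B D D' → (A :+ B) :+ (D :+ D') := (A :+ D) :+ (B :+ D')) refl A (- B) D (- D) ⟩
    (A + D) + (- B + - D)
      ≈⟨ +-congʳ (trans (sym (×-homo-+ 1# a d)) (trans (reflexive (P.cong cast e)) (×-homo-+ 1# c₁ b))) ⟩
    (C + B) + (- B + - D)
      ≈⟨ NS.solve 4 (λ C B B' D' → (C :+ B) :+ (B' :+ D') := (C :+ D') :+ (B :+ B')) refl C B (- B) (- D) ⟩
    (C + - D) + (B + - B)     ≈⟨ +-congˡ (-‿inverseʳ B) ⟩
    (C + - D) + 0#            ≈⟨ +-identityʳ _ ⟩
    C + - D                   ∎)
    where
    open NS
    A = cast a
    B = cast b
    C = cast c₁
    D = cast d

  ℤ-morphism : ℤ-as-pairs -Raw-AlmostCommutative⟶ fromCommutativeRing R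
  ℤ-morphism = record
    { ⟦_⟧ = ⟦_⟧ℤ ; +-homo = +-homo ; *-homo = *-homo ; -‿homo = -‿homo
    ; 0-homo = -‿inverseʳ 0#
    ; 1-homo = trans (+-assoc _ _ _) (trans (+-congˡ (-‿inverseʳ 0#)) (+-identityʳ _))
    }

  open import Algebra.Solver.Ring ℤ-as-pairs (fromCommutativeRing R) ℤ-morphism coefficient-equality public

module Valuation {c ℓ : Level} (L : LocalField c ℓ) where
  open LocalField L
  open IntegerSolver cring using (solve; _:+_; _:*_; _:-_; _:=_)
  open import Relation.Binary.Reasoning.Setoid setoid

  infix 4 _∈𝔭
  _∈𝔭 : Carrier → Set (c ⊔ ℓ)
  x ∈𝔭 = ∃[ y ] (𝔬 y × x ≈ ϖ * y)

  ϖ^ℕ-+ : ∀ i j → ϖ^ℕ (i ℕ.+ j) ≈ ϖ^ℕ i * ϖ^ℕ j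
  ϖ^ℕ-+ zero    j = sym (*-identityˡ _)
  ϖ^ℕ-+ (suc i) j = trans (*-congˡ (ϖ^ℕ-+ i j)) (sym (*-assoc _ _ _))

  ϖ^ℕ-inverse : ∀ k → ϖ^ℕ k * ϖ⁻^ℕ k ≈ 1#
  ϖ^ℕ-inverse zero    = *-identityˡ 1#
  ϖ^ℕ-inverse (suc k) = begin
    (ϖ * ϖ^ℕ k) * (ϖ⁻¹ * ϖ⁻^ℕ k)
      ≈⟨ solve 4 (λ p P q Q → (p :* P) :* (q :* Q) := (p :* q) :* (P :* Q)) refl ϖ (ϖ^ℕ k) ϖ⁻¹ (ϖ⁻^ℕ k) ⟩
    (ϖ * ϖ⁻¹) * (ϖ^ℕ k * ϖ⁻^ℕ k)   ≈⟨ *-cong ϖϖ⁻¹ (ϖ^ℕ-inverse k) ⟩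
    1# * 1#                        ≈⟨ *-identityˡ 1# ⟩
    1#                             ∎

  ϖ⁻^ℕ-transpose : ∀ k {x u} → x ≈ ϖ⁻^ℕ k * u → u ≈ ϖ^ℕ k * x
  ϖ⁻^ℕ-transpose k {x} {u} e = begin
    u                            ≈⟨ sym (*-identityˡ u) ⟩
    1# * u                       ≈⟨ *-congʳ (sym (ϖ^ℕ-inverse k)) ⟩
    (ϖ^ℕ k * ϖ⁻^ℕ k) * u         ≈⟨ *-assoc _ _ _ ⟩
    ϖ^ℕ k * (ϖ⁻^ℕ k * u)         ≈⟨ *-congˡ (sym e) ⟩
    ϖ^ℕ k * x                    ∎

  ϖ^ℕ-cancel : ∀ k {x y} → ϖ^ℕ k * x ≈ ϖ^ℕ k * y → x ≈ y
  ϖ^ℕ-cancel k {x} {y} e = begin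
    x                         ≈⟨ sym (cancelled x) ⟩
    ϖ⁻^ℕ k * (ϖ^ℕ k * x)      ≈⟨ *-congˡ e ⟩
    ϖ⁻^ℕ k * (ϖ^ℕ k * y)      ≈⟨ cancelled y ⟩
    y                         ∎
    where
    cancelled : ∀ z → ϖ⁻^ℕ k * (ϖ^ℕ k * z) ≈ z
    cancelled z = trans (solve 3 (λ q p z → q :* (p :* z) := (p :* q) :* z) refl (ϖ⁻^ℕ k) (ϖ^ℕ k) z)
                        (trans (*-congʳ (ϖ^ℕ-inverse k)) (*-identityˡ z))

  ϖ^-neg : ∀ l → ϖ^ (ℤ.- (+ l)) ≈ ϖ⁻^ℕ l
  ϖ^-neg zero    = refl
  ϖ^-neg (suc l) = refl

  𝔬-ϖ^ℕ : ∀ k → 𝔬 (ϖ^ℕ k)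
  𝔬-ϖ^ℕ zero    = 𝔬-1
  𝔬-ϖ^ℕ (suc k) = 𝔬-* 𝔬-ϖ (𝔬-ϖ^ℕ k)

  ∈𝔭-resp : ∀ {x y} → x ≈ y → x ∈𝔭 → y ∈𝔭
  ∈𝔭-resp e (z , oz , xz) = z , oz , trans (sym e) xz

  ∈𝔭⇒𝔬 : ∀ {x} → x ∈𝔭 → 𝔬 x
  ∈𝔭⇒𝔬 (z , oz , xz) = 𝔬-resp (sym xz) (𝔬-* 𝔬-ϖ oz)

  0∈𝔭 : 0# ∈𝔭
  0∈𝔭 = 0# , 𝔬-0 , sym (zeroʳ ϖ)

  ∈𝔭-- : ∀ {x y} → x ∈𝔭 → y ∈𝔭 → (x - y) ∈𝔭
  ∈𝔭-- {x} {y} (p , op , xp) (q , oq , yq) = p - q , 𝔬-+ op (𝔬-neg oq) , (begin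
    x - y                ≈⟨ +-cong xp (-‿cong yq) ⟩
    ϖ * p - ϖ * q        ≈⟨ solve 3 (λ w p q → w :* p :- w :* q := w :* (p :- q)) refl ϖ p q ⟩
    ϖ * (p - q)          ∎)

  ∈𝔭-*ˡ : ∀ {x y} → 𝔬 x → y ∈𝔭 → (x * y) ∈𝔭
  ∈𝔭-*ˡ {x} ox (q , oq , yq) = x * q , 𝔬-* ox oq ,
    trans (*-congˡ yq) (solve 3 (λ x w q → x :* (w :* q) := w :* (x :* q)) refl x ϖ q)

  ∈𝔭-*ʳ : ∀ {x y} → x ∈𝔭 → 𝔬 y → (x * y) ∈𝔭
  ∈𝔭-*ʳ x∈𝔭 oy = ∈𝔭-resp (*-comm _ _) (∈𝔭-*ˡ oy x∈𝔭)

  ϖ^suc∈𝔭 : ∀ j {x} → 𝔬 x → (ϖ^ℕ (suc j) * x) ∈𝔭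
  ϖ^suc∈𝔭 j ox = _ , 𝔬-* (𝔬-ϖ^ℕ j) ox , *-assoc _ _ _

  𝔭^suc⇒∈𝔭 : ∀ j {x} → 𝔭^ (suc j) x → x ∈𝔭
  𝔭^suc⇒∈𝔭 j (y , oy , xy) = ∈𝔭-resp (sym xy) (ϖ^suc∈𝔭 j oy)

  ∈𝔭⇒𝔭^1 : ∀ {x} → x ∈𝔭 → 𝔭^ 1 x
  ∈𝔭⇒𝔭^1 (y , oy , xy) = y , oy , trans xy (*-congʳ (sym (*-identityʳ ϖ)))

  -- 𝔭 is a proper ideal: otherwise ϖ⁻¹ would be integral.
  1∉𝔭 : ¬ (1# ∈𝔭)
  1∉𝔭 (y , oy , 1≈ϖy) = ϖ-nonunit (𝔬-resp (sym ϖ⁻¹≈y) oy)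
    where
    ϖ⁻¹≈y : ϖ⁻¹ ≈ y
    ϖ⁻¹≈y = begin
      ϖ⁻¹             ≈⟨ sym (*-identityʳ _) ⟩
      ϖ⁻¹ * 1#        ≈⟨ *-congˡ 1≈ϖy ⟩
      ϖ⁻¹ * (ϖ * y)   ≈⟨ solve 3 (λ q p y → q :* (p :* y) := (p :* q) :* y) refl ϖ⁻¹ ϖ y ⟩
      (ϖ * ϖ⁻¹) * y   ≈⟨ *-congʳ ϖϖ⁻¹ ⟩
      1# * y          ≈⟨ *-identityˡ y ⟩
      y               ∎

  𝔬ˣ-resp : ∀ {x y} → x ≈ y → 𝔬ˣ x → 𝔬ˣ y
  𝔬ˣ-resp e (ox , i , oi , xi) = 𝔬-resp e ox , i , oi , trans (*-congʳ (sym e)) xi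

  𝔬ˣ-* : ∀ {x y} → 𝔬ˣ x → 𝔬ˣ y → 𝔬ˣ (x * y)
  𝔬ˣ-* {x} {y} (ox , i , oi , xi) (oy , j , oj , yj) = 𝔬-* ox oy , i * j , 𝔬-* oi oj ,
    trans (solve 4 (λ x y i j → (x :* y) :* (i :* j) := (x :* i) :* (y :* j)) refl x y i j)
          (trans (*-cong xi yj) (*-identityˡ 1#))

  𝔬ˣ-factorʳ : ∀ {x y} → 𝔬 x → 𝔬 y → 𝔬ˣ (x * y) → 𝔬ˣ y
  𝔬ˣ-factorʳ {x} {y} ox oy (_ , i , oi , xyi) = oy , x * i , 𝔬-* ox oi ,
    trans (solve 3 (λ x y i → y :* (x :* i) := (x :* y) :* i) refl x y i) xyi

  𝔬ˣ-factorˡ : ∀ {x y} → 𝔬 x → 𝔬 y → 𝔬ˣ (x * y) → 𝔬ˣ x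
  𝔬ˣ-factorˡ ox oy xyU = 𝔬ˣ-factorʳ oy ox (𝔬ˣ-resp (*-comm _ _) xyU)

  unit∉𝔭 : ∀ {x} → 𝔬ˣ x → ¬ (x ∈𝔭)
  unit∉𝔭 (_ , i , oi , xi) x∈𝔭 = 1∉𝔭 (∈𝔭-resp xi (∈𝔭-*ʳ x∈𝔭 oi))

  -- 𝔬 is local with maximal ideal 𝔭: an integer outside 𝔭 is a unit.  This
  -- is where the discrete valuation is used.
  𝔬∖𝔭⊆𝔬ˣ : ∀ {x} → 𝔬 x → ¬ (x ∈𝔭) → 𝔬ˣ x
  𝔬∖𝔭⊆𝔬ˣ {x} ox x∉𝔭 with dvr x (λ x≈0 → x∉𝔭 (∈𝔭-resp (sym x≈0) 0∈𝔭))
  ... | + zero    , u , uU , x≈u = 𝔬ˣ-resp (sym (trans x≈u (*-identityˡ u))) uU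
  ... | + suc j   , u , uU , x≈ϖu = ⊥-elim (x∉𝔭 (∈𝔭-resp (sym x≈ϖu) (ϖ^suc∈𝔭 j (proj₁ uU))))
  ... | -[1+ j ]  , u , uU , x≈ϖ⁻u =
    ⊥-elim (unit∉𝔭 uU (∈𝔭-resp (sym (ϖ⁻^ℕ-transpose (suc j) x≈ϖ⁻u)) (ϖ^suc∈𝔭 j ox)))

  𝔬ˣ-+𝔭 : ∀ {e p} → 𝔬ˣ e → p ∈𝔭 → 𝔬ˣ (e + p)
  𝔬ˣ-+𝔭 {e} {p} eU p∈𝔭 = 𝔬∖𝔭⊆𝔬ˣ (𝔬-+ (proj₁ eU) (∈𝔭⇒𝔬 p∈𝔭))
    (λ s∈𝔭 → unit∉𝔭 eU (∈𝔭-resp (solve 2 (λ e p → (e :+ p) :- p := e) refl e p) (∈𝔭-- s∈𝔭 p∈𝔭)))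

  ∈𝔭-unit-cancel : ∀ {x u} → (x * u) ∈𝔭 → 𝔬ˣ u → x ∈𝔭
  ∈𝔭-unit-cancel {x} {u} xu∈𝔭 (_ , u' , ou' , uu') = ∈𝔭-resp x≈ (∈𝔭-*ʳ xu∈𝔭 ou')
    where
    x≈ : (x * u) * u' ≈ x
    x≈ = trans (*-assoc _ _ _) (trans (*-congˡ uu') (*-identityʳ x))

module Matrices {c ℓ : Level} (L : LocalField c ℓ) where
  open LocalField L
  open GL2 L
  open Valuation L
  open IntegerSolver cring using (solve; _:+_; _:*_; _:-_; :-_; _:=_)
  open import Relation.Binary.Reasoning.Setoid setoid
  open import Algebra.Properties.Ring ring using (-‿distribˡ-*; -‿distribʳ-*; -‿involutive)

  0*+1* : ∀ p q → 0# * p + 1# * q ≈ q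
  0*+1* p q = trans (+-cong (zeroˡ p) (*-identityˡ q)) (+-identityˡ q)

  -- An element of K whose off-diagonal product b·c lies in 𝔭 has unit
  -- diagonal entries, since a·d = det + b·c.
  diagonal-units : ∀ {κ} → InK κ → (b κ * c' κ) ∈𝔭 → 𝔬ˣ (a κ) × 𝔬ˣ (d κ)
  diagonal-units {κ} (oa , ob , oc , od , detU) bc∈𝔭 = 𝔬ˣ-factorˡ oa od adU , 𝔬ˣ-factorʳ oa od adU
    where
    adU : 𝔬ˣ (a κ * d κ)
    adU = 𝔬ˣ-resp (solve 4 (λ a b c d → (a :* d :- b :* c) :+ b :* c := a :* d) refl (a κ) (b κ) (c' κ) (d κ))
                  (𝔬ˣ-+𝔭 detU bc∈𝔭)

  K⁰-d-unit : ∀ {κ} → InK⁰ κ → 𝔬ˣ (d κ)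
  K⁰-d-unit (κK@(_ , _ , oc , _) , b∈𝔭¹) = proj₂ (diagonal-units κK (∈𝔭-*ʳ (𝔭^suc⇒∈𝔭 0 b∈𝔭¹) oc))

  K₁-diagonal-units : ∀ j {κ} → InK1 (suc j) κ → 𝔬ˣ (a κ) × 𝔬ˣ (d κ)
  K₁-diagonal-units j ((κK@(_ , ob , _) , c∈𝔭ʲ , _)) = diagonal-units κK (∈𝔭-*ˡ ob (𝔭^suc⇒∈𝔭 j c∈𝔭ʲ))

  NoK⁰⇒d-unit : ∀ {k} → InNoK⁰ k → 𝔬ˣ (d k)
  NoK⁰⇒d-unit (_ , κ , _ , κK⁰ , k≈) =
    𝔬ˣ-resp (sym (trans (proj₂ (proj₂ (proj₂ k≈))) (0*+1* (b κ) (d κ)))) (K⁰-d-unit κK⁰)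

  d-unit⇒NoK⁰ : ∀ {k} → InK k → 𝔬ˣ (d k) → InNoK⁰ k
  d-unit⇒NoK⁰ {k} (oa , ob , oc , od , detU) (_ , d' , od' , dd') =
    x , κ , ox , (κK , 0# , 𝔬-0 , b≈0) , k≈
    where
    x = b k * d'
    ox = 𝔬-* ob od'
    -- κ = n(−x)·k, whose upper right entry b − x·d vanishes
    κ = mat (a k - x * c' k) (b k - x * d k) (c' k) (d k)
    add-back : ∀ p q → p ≈ (p - q) + q
    add-back p q = solve 2 (λ p q → p := (p :- q) :+ q) refl p q
    k≈ : k ≈M n[ x ] · κ
    k≈ = trans (add-back (a k) (x * c' k)) (+-congʳ (sym (*-identityˡ _))) ,
         trans (add-back (b k) (x * d k)) (+-congʳ (sym (*-identityˡ _))) ,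
         sym (0*+1* _ _) , sym (0*+1* _ _)
    κK : InK κ
    κK = 𝔬-+ oa (𝔬-neg (𝔬-* ox oc)) , 𝔬-+ ob (𝔬-neg (𝔬-* ox od)) , oc , od ,
         𝔬ˣ-resp (solve 5 (λ a b c d x → a :* d :- b :* c := (a :- x :* c) :* d :- (b :- x :* d) :* c)
                          refl (a k) (b k) (c' k) (d k) x) detU
    b≈0 : b k - x * d k ≈ (ϖ * 1#) * 0#
    b≈0 = begin
      b k - b k * d' * d k      ≈⟨ +-congˡ (-‿cong (trans (*-assoc _ _ _) (*-congˡ (trans (*-comm _ _) dd')))) ⟩
      b k - b k * 1#            ≈⟨ +-congˡ (-‿cong (*-identityʳ _)) ⟩
      b k - b k                 ≈⟨ -‿inverseʳ _ ⟩
      0#                        ≈⟨ sym (zeroʳ _) ⟩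
      (ϖ * 1#) * 0#             ∎

  wK⁰⇒d∈𝔭 : ∀ {k} → InwK⁰ k → d k ∈𝔭
  wK⁰⇒d∈𝔭 {k} (κ , (_ , b∈𝔭¹) , k≈) = ∈𝔭-resp (sym d≈) (∈𝔭-*ˡ (𝔬-neg 𝔬-1) (𝔭^suc⇒∈𝔭 0 b∈𝔭¹))
    where
    d≈ : d k ≈ - 1# * b κ
    d≈ = trans (proj₂ (proj₂ (proj₂ k≈))) (trans (+-congˡ (zeroˡ _)) (+-identityʳ _))

  d∈𝔭⇒wK⁰ : ∀ {k} → InK k → d k ∈𝔭 → InwK⁰ k
  d∈𝔭⇒wK⁰ {k} (oa , ob , oc , od , detU) d∈𝔭 = κ , (κK , ∈𝔭⇒𝔭^1 -d∈𝔭) , k≈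
    where
    -- κ = w⁻¹·k
    κ = mat (- c' k) (- d k) (a k) (b k)
    κK : InK κ
    κK = 𝔬-neg oc , 𝔬-neg od , oa , ob ,
      𝔬ˣ-resp (solve 4 (λ a b c d → a :* d :- b :* c := (:- c) :* b :- (:- d) :* a) refl (a k) (b k) (c' k) (d k)) detU
    -d∈𝔭 : (- d k) ∈𝔭
    -d∈𝔭 = ∈𝔭-resp (+-identityˡ _) (∈𝔭-- 0∈𝔭 d∈𝔭)
    -1*-+0* : ∀ p q → - 1# * - p + 0# * q ≈ p
    -1*-+0* p q = begin
      - 1# * - p + 0# * q   ≈⟨ +-cong (sym (-‿distribˡ-* 1# (- p))) (zeroˡ q) ⟩
      - (1# * - p) + 0#     ≈⟨ +-identityʳ _ ⟩
      - (1# * - p)          ≈⟨ -‿cong (*-identityˡ _) ⟩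
      - - p                 ≈⟨ -‿involutive p ⟩
      p                     ∎
    k≈ : k ≈M w · κ
    k≈ = sym (0*+1* _ _) , sym (0*+1* _ _) , sym (-1*-+0* _ _) , sym (-1*-+0* _ _)

  record BottomRow (g : M2) (p q : Carrier) : Set ℓ where
    constructor row
    field
      c'≈ : c' g ≈ p
      d≈  : d g ≈ q
  open BottomRow

  BottomRow-resp : ∀ {g p q p' q'} → p ≈ p' → q ≈ q' → BottomRow g p q → BottomRow g p' q'
  BottomRow-resp pp' qq' (row cp dq) = row (trans cp pp') (trans dq qq')

  BottomRow-· : ∀ {g p q} h → BottomRow g p q →
                BottomRow (g · h) (p * a h + q * c' h) (p * b h + q * d h)
  BottomRow-· h (row cp dq) = row (+-cong (*-congʳ cp) (*-congʳ dq)) (+-cong (*-congʳ cp) (*-congʳ dq))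

  BottomRow-n : ∀ {g p q} x → BottomRow g p q → BottomRow (g · n[ x ]) p (p * x + q)
  BottomRow-n x bot = BottomRow-resp (trans (+-cong (*-identityʳ _) (zeroʳ _)) (+-identityʳ _))
                                     (+-congˡ (*-identityʳ _))
                                     (BottomRow-· n[ x ] bot)

  BottomRow-a : ∀ {g p q} s → BottomRow g p q → BottomRow (g · a[ s ]) (p * s) q
  BottomRow-a s bot = BottomRow-resp (trans (+-congˡ (zeroʳ _)) (+-identityʳ _))
                                     (trans (+-cong (zeroʳ _) (*-identityʳ _)) (+-identityˡ _))
                                     (BottomRow-· a[ s ] bot)

  BottomRow-w : ∀ {g p q} → BottomRow g p q → BottomRow (g · w) (- q) p
  BottomRow-w bot = BottomRow-resp
    (trans (+-cong (zeroʳ _) (sym (-‿distribʳ-* _ 1#))) (trans (+-identityˡ _) (-‿cong (*-identityʳ _))))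
    (trans (+-cong (*-identityʳ _) (zeroʳ _)) (+-identityʳ _))
    (BottomRow-· w bot)

  BottomRow-cell : ∀ z x s u κ → BottomRow (scalar z · n[ x ] · a[ s ] · w · n[ u ] · κ)
                                           (- z * (a κ + u * c' κ)) (- z * (b κ + u * d κ))
  BottomRow-cell z x s u κ =
    BottomRow-resp (factor (a κ) (c' κ)) (factor (b κ) (d κ))
      (BottomRow-· κ (BottomRow-resp refl (+-identityʳ _)
        (BottomRow-n u (BottomRow-w (BottomRow-resp (zeroˡ s) refl
          (BottomRow-a s (BottomRow-resp refl 0*x+z≈z
            (BottomRow-n x scalar-row))))))))
    where
    scalar-row : BottomRow (scalar z) 0# z
    scalar-row = row refl refl
    0*x+z≈z : 0# * x + z ≈ z
    0*x+z≈z = trans (+-congʳ (zeroˡ x)) (+-identityˡ z)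
    factor : ∀ p q → - z * p + - z * u * q ≈ - z * (p + u * q)
    factor p q = solve 4 (λ z u p q → (:- z) :* p :+ (:- z) :* u :* q := (:- z) :* (p :+ u :* q)) refl z u p q

  -- The relation between k and the K₁(𝔭ⁿ)-component κ of k·a(y), obtained by
  -- comparing bottom rows (which eliminates z) and clearing the
  -- denominator ϖ^{-l} of n(ϖ^{-l}v).
  CellRelation : M2 → Carrier → ℕ → Carrier → M2 → Set ℓ
  CellRelation k y l v κ = d k * (ϖ^ℕ l * a κ + v * c' κ) ≈ c' k * y * (ϖ^ℕ l * b κ + v * d κ)

  Cell : ℕ → M2 → Carrier → ℕ → Set (c ⊔ ℓ)
  Cell n k y l = ∃[ v ] ∃[ κ ] (𝔬ˣ v × InK1 n κ × CellRelation k y l v κ)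

  cell-relation : ∀ {n k y l} → Lval n (k · a[ y ]) l → Cell n k y l
  cell-relation {k = k} {y} {l} (t , _ , z , x , v , κ , _ , vU , κK₁ , k≈) = v , κ , vU , κK₁ , relation
    where
    Pw = ϖ^ℕ l
    u = ϖ^ (ℤ.- (+ l)) * v
    A = a κ + u * c' κ
    B = b κ + u * d κ
    lhs : BottomRow (k · a[ y ]) (c' k * y) (d k)
    lhs = BottomRow-a y (row refl refl)
    rhs : BottomRow (scalar z · n[ x ] · a[ ϖ^ t ] · w · n[ u ] · κ) (- z * A) (- z * B)
    rhs = BottomRow-cell z x (ϖ^ t) u κ
    cy≈ : c' k * y ≈ - z * A
    cy≈ = trans (sym (c'≈ lhs)) (trans (proj₁ (proj₂ (proj₂ k≈))) (c'≈ rhs))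
    dk≈ : d k ≈ - z * B
    dk≈ = trans (sym (d≈ lhs)) (trans (proj₂ (proj₂ (proj₂ k≈))) (d≈ rhs))
    Pw*u : Pw * u ≈ v
    Pw*u = begin
      Pw * (ϖ^ (ℤ.- (+ l)) * v)  ≈⟨ *-congˡ (*-congʳ (ϖ^-neg l)) ⟩
      Pw * (ϖ⁻^ℕ l * v)          ≈⟨ sym (*-assoc _ _ _) ⟩
      (Pw * ϖ⁻^ℕ l) * v          ≈⟨ *-congʳ (ϖ^ℕ-inverse l) ⟩
      1# * v                     ≈⟨ *-identityˡ v ⟩
      v                          ∎
    clear : ∀ p q → Pw * (p + u * q) ≈ Pw * p + v * q
    clear p q = trans (solve 4 (λ P p u q → P :* (p :+ u :* q) := P :* p :+ (P :* u) :* q) refl Pw p u q)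
                      (+-congˡ (*-congʳ Pw*u))
    relation : CellRelation k y l v κ
    relation = begin
      d k * (Pw * a κ + v * c' κ)        ≈⟨ *-congˡ (sym (clear _ _)) ⟩
      d k * (Pw * A)                     ≈⟨ *-congʳ dk≈ ⟩
      - z * B * (Pw * A)                 ≈⟨ solve 4 (λ z A B P → (:- z) :* B :* (P :* A) := (:- z) :* A :* (P :* B)) refl z A B Pw ⟩
      - z * A * (Pw * B)                 ≈⟨ *-congʳ (sym cy≈) ⟩
      c' k * y * (Pw * B)                ≈⟨ *-congˡ (clear _ _) ⟩
      c' k * y * (Pw * b κ + v * d κ)    ∎

  -- For k ∈ K, if its bottom row satisfies d·A = c·Y with A ∈ 𝔬 and Y ∈ 𝔬ˣ,
  -- then d is a unit, because det(k)·Y = (a·Y − b·A)·d.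
  row-with-unit-ratio : ∀ {k A Y} → InK k → 𝔬 A → 𝔬ˣ Y → d k * A ≈ c' k * Y → 𝔬ˣ (d k)
  row-with-unit-ratio {k} {A} {Y} (oa , ob , oc , od , detU) oA YU dA≈cY =
    𝔬ˣ-factorʳ oX od (𝔬ˣ-resp det*Y≈ (𝔬ˣ-* detU YU))
    where
    X = a k * Y - b k * A
    oX : 𝔬 X
    oX = 𝔬-+ (𝔬-* oa (proj₁ YU)) (𝔬-neg (𝔬-* ob oA))
    det*Y≈ : det k * Y ≈ X * d k
    det*Y≈ = begin
      (a k * d k - b k * c' k) * Y
        ≈⟨ solve 5 (λ a b c d Y → (a :* d :- b :* c) :* Y := a :* d :* Y :- b :* (c :* Y)) refl (a k) (b k) (c' k) (d k) Y ⟩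
      a k * d k * Y - b k * (c' k * Y)   ≈⟨ +-congˡ (-‿cong (*-congˡ (sym dA≈cY))) ⟩
      a k * d k * Y - b k * (d k * A)
        ≈⟨ solve 5 (λ a b A d Y → a :* d :* Y :- b :* (d :* A) := (a :* Y :- b :* A) :* d) refl (a k) (b k) A (d k) Y ⟩
      X * d k                            ∎

  -- Level l ≥ m+1: writing l = (m+1) + r, the factor ϖ^l b_κ + v d_κ is a
  -- unit and ϖ^{m+1} divides ϖ^l a_κ + v c_κ, so d_k is a unit.
  large-level⇒d-unit : ∀ m {k l} → InK k → suc m ℕ.≤ l → Cell (suc (m ℕ.+ m)) k (ϖ^ℕ (suc m)) l → 𝔬ˣ (d k)
  large-level⇒d-unit m {k} {l} kK m<l (v , κ , vU , κK₁@((oa , ob , _) , (γ , oγ , c≈) , _) , rel) =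
    row-with-unit-ratio kK oA YU (ϖ^ℕ-cancel (suc m) scaled)
    where
    r = proj₁ (ℕP.m≤n⇒∃[o]m+o≡n m<l)
    Pw = ϖ^ℕ l
    Pw≈ : ϖ^ℕ (suc m ℕ.+ r) ≈ Pw
    Pw≈ = reflexive (P.cong ϖ^ℕ (proj₂ (ℕP.m≤n⇒∃[o]m+o≡n m<l)))
    y = ϖ^ℕ (suc m)
    Y = Pw * b κ + v * d κ
    YU : 𝔬ˣ Y
    YU = 𝔬ˣ-resp (+-comm _ _)
           (𝔬ˣ-+𝔭 (𝔬ˣ-* vU (proj₂ (K₁-diagonal-units (m ℕ.+ m) κK₁)))
                  (∈𝔭-resp (*-congʳ Pw≈) (ϖ^suc∈𝔭 (m ℕ.+ r) ob)))
    A = ϖ^ℕ r * a κ + v * (ϖ^ℕ m * γ)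
    oA : 𝔬 A
    oA = 𝔬-+ (𝔬-* (𝔬-ϖ^ℕ r) oa) (𝔬-* (proj₁ vU) (𝔬-* (𝔬-ϖ^ℕ m) oγ))
    y*A : y * A ≈ Pw * a κ + v * c' κ
    y*A = begin
      y * (ϖ^ℕ r * a κ + v * (ϖ^ℕ m * γ))
        ≈⟨ solve 6 (λ y R a v M g → y :* (R :* a :+ v :* (M :* g)) := (y :* R) :* a :+ v :* ((y :* M) :* g))
                   refl y (ϖ^ℕ r) (a κ) v (ϖ^ℕ m) γ ⟩
      (y * ϖ^ℕ r) * a κ + v * ((y * ϖ^ℕ m) * γ)
        ≈⟨ +-cong (*-congʳ (trans (sym (ϖ^ℕ-+ (suc m) r)) Pw≈))
                  (*-congˡ (trans (*-congʳ (sym (ϖ^ℕ-+ (suc m) m))) (sym c≈))) ⟩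
      Pw * a κ + v * c' κ ∎
    scaled : y * (d k * A) ≈ y * (c' k * Y)
    scaled = begin
      y * (d k * A)                 ≈⟨ solve 3 (λ y d A → y :* (d :* A) := d :* (y :* A)) refl y (d k) A ⟩
      d k * (y * A)                 ≈⟨ *-congˡ y*A ⟩
      d k * (Pw * a κ + v * c' κ)   ≈⟨ rel ⟩
      c' k * y * Y                  ≈⟨ solve 3 (λ c y Y → c :* y :* Y := y :* (c :* Y)) refl (c' k) y Y ⟩
      y * (c' k * Y)                ∎

  -- Level l ≤ m: writing m = l + r and cancelling ϖ^l, d_k times the unit
  -- a_κ + ϖ^{r+m+1} v γ is divisible by ϖ^{r+1}, so d_k ∈ 𝔭.
  small-level⇒d∈𝔭 : ∀ m {k l} → InK k → l ℕ.≤ m → Cell (suc (m ℕ.+ m)) k (ϖ^ℕ (suc m)) l → d k ∈𝔭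
  small-level⇒d∈𝔭 m {k} {l} (_ , _ , oc , _) l≤m
                   (v , κ , vU , κK₁@((_ , ob , _ , od , _) , (γ , oγ , c≈) , _) , rel) =
    ∈𝔭-unit-cancel (∈𝔭-resp (sym dU≈) (ϖ^suc∈𝔭 r (𝔬-* oc oY))) UU
    where
    r = proj₁ (ℕP.m≤n⇒∃[o]m+o≡n l≤m)
    l+r≡m : l ℕ.+ r ≡ m
    l+r≡m = proj₂ (ℕP.m≤n⇒∃[o]m+o≡n l≤m)
    Pw = ϖ^ℕ l
    Q = ϖ^ℕ (suc (r ℕ.+ m))
    U = a κ + Q * (v * γ)
    UU : 𝔬ˣ U
    UU = 𝔬ˣ-+𝔭 (proj₁ (K₁-diagonal-units (m ℕ.+ m) κK₁)) (ϖ^suc∈𝔭 (r ℕ.+ m) (𝔬-* (proj₁ vU) oγ))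
    Y = Pw * b κ + v * d κ
    oY : 𝔬 Y
    oY = 𝔬-+ (𝔬-* (𝔬-ϖ^ℕ l) ob) (𝔬-* (proj₁ vU) od)
    c-exponent : suc (m ℕ.+ m) ≡ l ℕ.+ suc (r ℕ.+ m)
    c-exponent = P.trans (P.cong (λ j → suc (j ℕ.+ m)) (P.sym l+r≡m))
                   (P.trans (P.cong suc (ℕP.+-assoc l r m)) (P.sym (ℕP.+-suc l (r ℕ.+ m))))
    y-exponent : suc m ≡ l ℕ.+ suc r
    y-exponent = P.trans (P.cong suc (P.sym l+r≡m)) (P.sym (ℕP.+-suc l r))
    c≈' : c' κ ≈ (Pw * Q) * γ
    c≈' = trans c≈ (*-congʳ (trans (reflexive (P.cong ϖ^ℕ c-exponent)) (ϖ^ℕ-+ l (suc (r ℕ.+ m)))))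
    y≈ : ϖ^ℕ (suc m) ≈ Pw * ϖ^ℕ (suc r)
    y≈ = trans (reflexive (P.cong ϖ^ℕ y-exponent)) (ϖ^ℕ-+ l (suc r))
    Pw*U : Pw * U ≈ Pw * a κ + v * c' κ
    Pw*U = trans (solve 5 (λ P a Q v g → P :* (a :+ Q :* (v :* g)) := P :* a :+ v :* ((P :* Q) :* g))
                          refl Pw (a κ) Q v γ)
                 (+-congˡ (*-congˡ (sym c≈')))
    scaled : Pw * (d k * U) ≈ Pw * (ϖ^ℕ (suc r) * (c' k * Y))
    scaled = begin
      Pw * (d k * U)                 ≈⟨ solve 3 (λ P d U → P :* (d :* U) := d :* (P :* U)) refl Pw (d k) U ⟩
      d k * (Pw * U)                 ≈⟨ *-congˡ Pw*U ⟩
      d k * (Pw * a κ + v * c' κ)    ≈⟨ rel ⟩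
      c' k * ϖ^ℕ (suc m) * Y         ≈⟨ *-congʳ (*-congˡ y≈) ⟩
      c' k * (Pw * ϖ^ℕ (suc r)) * Y
        ≈⟨ solve 4 (λ c P R Y → c :* (P :* R) :* Y := P :* (R :* (c :* Y))) refl (c' k) Pw (ϖ^ℕ (suc r)) Y ⟩
      Pw * (ϖ^ℕ (suc r) * (c' k * Y)) ∎
    dU≈ : d k * U ≈ ϖ^ℕ (suc r) * (c' k * Y)
    dU≈ = ϖ^ℕ-cancel l scaled

  odd-level-theorem : ∀ m k → InK k →
    (∀ l → Lval (suc (m ℕ.+ m)) (k · a[ ϖ^ℕ (suc m) ]) l → (suc m ℕ.≤ l ⇔ InNoK⁰ k))
    × (∀ l → Lval (suc (m ℕ.+ m)) (k · a[ ϖ^ℕ (suc m) ]) l → (l ℕ.≤ m ⇔ InwK⁰ k))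
  odd-level-theorem m k kK = (λ l lv → proj₁ (both l lv)) , (λ l lv → proj₂ (both l lv))
    where
    both : ∀ l → Lval (suc (m ℕ.+ m)) (k · a[ ϖ^ℕ (suc m) ]) l →
           (suc m ℕ.≤ l ⇔ InNoK⁰ k) × (l ℕ.≤ m ⇔ InwK⁰ k)
    both l lv = exclusive-cases (ℕP.<-≤-connex m l)
      (λ m<l → d-unit⇒NoK⁰ kK (large-level⇒d-unit m kK m<l (cell-relation lv)))
      (λ l≤m → d∈𝔭⇒wK⁰ kK (small-level⇒d∈𝔭 m kK l≤m (cell-relation lv)))
      (λ k∈NoK⁰ k∈wK⁰ → unit∉𝔭 (NoK⁰⇒d-unit k∈NoK⁰) (wK⁰⇒d∈𝔭 k∈wK⁰))

open import Data.Nat using (_≤_; _+_; _∸_; _/_; _%_; _*_)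

double : ∀ m → m + m ≡ m * 2
double = solve-∀

odd⇒suc-double : ∀ n → n % 2 ≡ 1 → ∃[ m ] (n ≡ suc (m + m))
odd⇒suc-double n n-odd = n / 2 , (begin
  n                   ≡⟨ m≡m%n+[m/n]*n n 2 ⟩
  n % 2 + n / 2 * 2   ≡⟨ P.cong₂ _+_ n-odd (P.sym (double (n / 2))) ⟩
  suc (n / 2 + n / 2) ∎)
  where open P.≡-Reasoning

half-up : ∀ m → (suc (m + m) + 1) / 2 ≡ suc m
half-up m = P.trans (P.cong (_/ 2) (suc-double+1 m)) (m*n/n≡m (suc m) 2)
  where
  suc-double+1 : ∀ m → suc (m + m) + 1 ≡ suc m * 2
  suc-double+1 = solve-∀

half-down : ∀ m → (suc (m + m) ∸ 1) / 2 ≡ m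
half-down m = P.trans (P.cong (_/ 2) (double m)) (m*n/n≡m m 2)

mainTheorem7 : {c ℓ : Level} (L : LocalField c ℓ) (n : ℕ) → n % 2 ≡ 1 →
    (k : GL2.M2 L) → GL2.InK L k →
    (∀ l → GL2.Lval L n (GL2._·_ L k (GL2.a[_] L (LocalField.ϖ^ℕ L ((n + 1) / 2)))) l →
       (((n + 1) / 2 ≤ l) ⇔ GL2.InNoK⁰ L k))
    × (∀ l → GL2.Lval L n (GL2._·_ L k (GL2.a[_] L (LocalField.ϖ^ℕ L ((n + 1) / 2)))) l →
       ((l ≤ (n ∸ 1) / 2) ⇔ GL2.InwK⁰ L k))
mainTheorem7 L n n-odd k kK with odd⇒suc-double n n-odd
... | m , P.refl rewrite half-up m | half-down m = Matrices.odd-level-theorem L m k kK
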